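{- Let $T$ be a finite tree and let $v$ be a vertex of $T$ adjacent to two leaves $u$ and $w$. Then $\gamma_{all,2}^\infty(T)=\gamma_{all,2}^\infty(T-u)$.
   Context: Eternal distance-$k$ domination: guards are placed on vertices of a graph $G$ (several guards may occupy the same vertex) so that the occupied vertices form a distance-$k$ dominating set (every vertex within distance $k$ of an occupied vertex). In each round an attacker chooses a vertex; every guard may move to any vertex at distance at most $k$ from its current position (or stay), after which the attacked vertex must be occupied and the occupied vertices again distance-$k$ dominating. $\gamma_{all,k}^\infty(G)$ is the minimum number of guards allowing the guards to answer every infinite sequence of attacks. -}

module Defs where

open import Data.Nat using (ℕ; zero; suc; _+_; _≤_)
open import Data.Fin using (Fin; zero; suc; inject₁; fromℕ; punchIn)
open import Data.Product using (Σ; ∃; _×_; _,_)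
open import Relation.Binary.PropositionalEquality using (_≡_; _≢_)
open import Relation.Nullary using (¬_)
open import Function.Definitions using (Injective)
open import Function.Bundles using (_⇔_)
open import Level using (0ℓ)

record Graph (n : ℕ) : Set₁ where
  field
    Adj   : Fin n → Fin n → Set
    sym   : ∀ {x y} → Adj x y → Adj y x
    irrfl : ∀ {x} → ¬ Adj x x

open Graph public

module _ {n : ℕ} (G : Graph n) where

  -- Reach k x y : there is a walk of length at most k from x to y,
  -- i.e. dist(x,y) ≤ k.
  data Reach : ℕ → Fin n → Fin n → Set where
    here : ∀ {k x} → Reach k x x
    step : ∀ {k x z y} → Adj G x z → Reach k z y → Reach (suc k) x y

  Connected : Set
  Connected = ∀ x y → ∃ λ k → Reach k x y

  Cycle : Set
  Cycle = Σ ℕ λ l → Σ (Fin (3 + l) → Fin n) λ c →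
            Injective _≡_ _≡_ c
          × (∀ (i : Fin (2 + l)) → Adj G (c (inject₁ i)) (c (suc i)))
          × Adj G (c (fromℕ (2 + l))) (c zero)

  Acyclic : Set
  Acyclic = ¬ Cycle

  IsTree : Set
  IsTree = Connected × Acyclic

  IsLeaf : Fin n → Set
  IsLeaf u = Σ (Fin n) λ y → Adj G u y × (∀ z → Adj G u z → z ≡ y)

  -- configurations of m guards (several guards may share a vertex)
  Config : ℕ → Set
  Config m = Fin m → Fin n

  Dominating : ℕ → ∀ {m} → Config m → Set
  Dominating k C = ∀ x → ∃ λ i → Reach k (C i) x

  Occupied : ∀ {m} → Config m → Fin n → Set
  Occupied C a = ∃ λ i → C i ≡ a

  Move : ℕ → ∀ {m} → Config m → Config m → Set
  Move k C C' = ∀ i → Reach k (C i) (C' i)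

  -- A winning strategy for m guards in the eternal distance-k domination
  -- game ("all guards move" model): a nonempty family S of configurations,
  -- each distance-k dominating, such that from every configuration in S
  -- and every attacked vertex a, the guards can move (each within distance k)
  -- to a configuration in S in which a is occupied.
  IsEternalStrategy : ℕ → (m : ℕ) → (Config m → Set) → Set
  IsEternalStrategy k m S =
      (Σ (Config m) S)
    × (∀ C → S C → Dominating k C)
    × (∀ C → S C → ∀ a → Σ (Config m) λ C' → S C' × Move k C C' × Occupied C' a)

  EternalDefends : ℕ → ℕ → Set₁
  EternalDefends k m = Σ (Config m → Set) λ S → IsEternalStrategy k m S

  -- γ_{all,k}^∞(G) = g, expressed as: g is the least number of guards that suffices
  IsEternalAllDomNum : ℕ → ℕ → Set₁
  IsEternalAllDomNum k g =
    EternalDefends k g × (∀ m → EternalDefends k m → g ≤ m)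

-- Vertex deletion G - u for G on Fin (suc n): vertices Fin n, embedded via punchIn u.
_─_ : ∀ {n} → Graph (suc n) → Fin (suc n) → Graph n
G ─ u = record
  { Adj   = λ x y → Adj G (punchIn u x) (punchIn u y)
  ; sym   = sym G
  ; irrfl = irrfl G
  }

{-# OPTIONS --safe #-}
module Submission where

open import Defs hiding (sym)
open import Data.Nat using (ℕ; suc; _+_)
open import Data.Fin using (Fin; punchIn; punchOut; _≟_)
open import Data.Fin.Properties using (punchInᵢ≢i; punchOut-cong; punchOut-punchIn; punchIn-punchOut)
open import Data.Product using (Σ; _×_; _,_)
open import Data.Empty using (⊥-elim)
open import Function using (_∘_; id)
open import Function.Bundles using (_⇔_; mk⇔; Equivalence)
import Function.Properties.Equivalence as ⇔
open import Relation.Nullary using (yes; no)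
open import Relation.Binary.PropositionalEquality
  using (_≡_; _≢_; _≗_; refl; sym; trans; subst; subst₂; cong)

-- Merging u into its twin w is a retraction of T onto T − u. Since u and w
-- have the same unique neighbour v, every vertex within distance 2 of w is
-- within distance 2 of u and conversely, so the retraction preserves and
-- reflects "distance at most 2". Guard strategies can then be pushed forward
-- along the retraction, and pulled back along a section that sends the image
-- of the attacked vertex to the attacked vertex itself; hence the same number
-- of guards suffices on both sides.

module _ {n : ℕ} {G : Graph n} where

  Reach-snoc : ∀ {k a b c} → Reach G k a b → Adj G b c → Reach G (suc k) a c
  Reach-snoc here        e = step e here
  Reach-snoc (step e′ r) e = step e′ (Reach-snoc r e)

  Reach-sym : ∀ {k a b} → Reach G k a b → Reach G k b a
  Reach-sym here       = here
  Reach-sym (step e r) = Reach-snoc (Reach-sym r) (Graph.sym G e)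

  leaf-neighbour-unique : ∀ {p q z} → IsLeaf G p → Adj G q p → Adj G p z → z ≡ q
  leaf-neighbour-unique (_ , _ , unique) qp pz =
    trans (unique _ pz) (sym (unique _ (Graph.sym G qp)))

  twin-leaf-Adj : ∀ {u v w b} → IsLeaf G u → Adj G v u → Adj G v w →
                  Adj G u b → Adj G w b
  twin-leaf-Adj lu vu vw ub =
    subst (Adj G _) (sym (leaf-neighbour-unique lu vu ub)) (Graph.sym G vw)

  -- The bound 2 + k is needed for b = w, which u reaches only through v.
  twin-leaf-Reach : ∀ {k u v w b} → IsLeaf G w → Adj G v u → Adj G v w →
                    Reach G (2 + k) w b → Reach G (2 + k) u b
  twin-leaf-Reach lw vu vw here       = step (Graph.sym G vu) (step vw here)
  twin-leaf-Reach lw vu vw (step e r) =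
    step (Graph.sym G vu) (subst (λ z → Reach G _ z _) (leaf-neighbour-unique lw vw e) r)

Reach-map : ∀ {N M} {G : Graph N} {H : Graph M} (f : Fin N → Fin M) →
            (∀ {a b} → Adj G a b → Adj H (f a) (f b)) →
            ∀ {k a b} → Reach G k a b → Reach H k (f a) (f b)
Reach-map f hom here       = here
Reach-map f hom (step e r) = step (hom e) (Reach-map f hom r)

record Retract (k : ℕ) {N M : ℕ} (G : Graph N) (H : Graph M) : Set where
  field
    section          : Fin M → Fin N
    retract          : Fin N → Fin M
    retract-section  : ∀ x → retract (section x) ≡ x
    Reach⇔           : ∀ {a b} → Reach G k a b ⇔ Reach H k (retract a) (retract b)

module _ {k N M : ℕ} {G : Graph N} {H : Graph M} (ρ : Retract k G H) where
  open Retract ρ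

  sectionThrough : Fin N → Fin M → Fin N
  sectionThrough a y with y ≟ retract a
  ... | yes _ = a
  ... | no  _ = section y

  retract-sectionThrough : ∀ a y → retract (sectionThrough a y) ≡ y
  retract-sectionThrough a y with y ≟ retract a
  ... | yes y≡ra = sym y≡ra
  ... | no  _    = retract-section y

  sectionThrough-hits : ∀ a y → y ≡ retract a → sectionThrough a y ≡ a
  sectionThrough-hits a y y≡ra with y ≟ retract a
  ... | yes _    = refl
  ... | no  y≢ra = ⊥-elim (y≢ra y≡ra)

  pushForward : ∀ {m} → EternalDefends G k m → EternalDefends H k m
  pushForward {m} (S , (C₀ , C₀∈S) , dominates , respond) =
    S′ , (retract ∘ C₀ , C₀ , C₀∈S , λ _ → refl) , dominates′ , respond′
    where
    S′ : Config H m → Set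
    S′ D = Σ (Config G m) λ C → S C × retract ∘ C ≗ D

    dominates′ : ∀ D → S′ D → Dominating H k D
    dominates′ D (C , C∈S , C↦D) x with dominates C C∈S (section x)
    ... | i , r = i , subst₂ (Reach H k) (C↦D i) (retract-section x) (Equivalence.to Reach⇔ r)

    respond′ : ∀ D → S′ D → ∀ x →
               Σ (Config H m) λ D′ → S′ D′ × Move H k D D′ × Occupied H D′ x
    respond′ D (C , C∈S , C↦D) x with respond C C∈S (section x)
    ... | C′ , C′∈S , moves , (j , C′j≡) =
      retract ∘ C′ , (C′ , C′∈S , λ _ → refl) ,
      (λ i → subst (λ y → Reach H k y _) (C↦D i) (Equivalence.to Reach⇔ (moves i))) ,
      (j , trans (cong retract C′j≡) (retract-section x))

  pullBack : ∀ {m} → EternalDefends H k m → EternalDefends G k m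
  pullBack {m} (S , (D₀ , D₀∈S) , dominates , respond) =
    S′ , (section ∘ D₀ , D₀ , D₀∈S , retract-section ∘ D₀) , dominates′ , respond′
    where
    S′ : Config G m → Set
    S′ C = Σ (Config H m) λ D → S D × retract ∘ C ≗ D

    dominates′ : ∀ C → S′ C → Dominating G k C
    dominates′ C (D , D∈S , C↦D) x with dominates D D∈S (retract x)
    ... | i , r = i , Equivalence.from Reach⇔ (subst (λ y → Reach H k y _) (sym (C↦D i)) r)

    respond′ : ∀ C → S′ C → ∀ a →
               Σ (Config G m) λ C′ → S′ C′ × Move G k C C′ × Occupied G C′ a
    respond′ C (D , D∈S , C↦D) a with respond D D∈S (retract a)
    ... | D′ , D′∈S , moves , (j , D′j≡) =
      sectionThrough a ∘ D′ , (D′ , D′∈S , retract-sectionThrough a ∘ D′) ,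
      (λ i → Equivalence.from Reach⇔
               (subst₂ (Reach H k) (sym (C↦D i)) (sym (retract-sectionThrough a (D′ i))) (moves i))) ,
      (j , sectionThrough-hits a (D′ j) D′j≡)

  Retract⇒EternalDefends⇔ : ∀ m → EternalDefends G k m ⇔ EternalDefends H k m
  Retract⇒EternalDefends⇔ m = mk⇔ pushForward pullBack

IsEternalAllDomNum-cong : ∀ {k N M} {G : Graph N} {H : Graph M} →
  (∀ m → EternalDefends G k m ⇔ EternalDefends H k m) →
  ∀ g → IsEternalAllDomNum G k g ⇔ IsEternalAllDomNum H k g
IsEternalAllDomNum-cong G⇔H g = mk⇔
  (λ (defends , least) → Equivalence.to (G⇔H g) defends , λ m → least m ∘ Equivalence.from (G⇔H m))
  (λ (defends , least) → Equivalence.from (G⇔H g) defends , λ m → least m ∘ Equivalence.to (G⇔H m))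

module TwinLeaves {n : ℕ} (G : Graph (suc n)) {u v w : Fin (suc n)}
  (lu : IsLeaf G u) (lw : IsLeaf G w) (u≢w : u ≢ w)
  (vu : Adj G v u) (vw : Adj G v w) where

  collapse : Fin (suc n) → Fin n
  collapse a with u ≟ a
  ... | yes _   = punchOut u≢w
  ... | no  u≢a = punchOut u≢a

  collapse-punchIn : ∀ x → collapse (punchIn u x) ≡ x
  collapse-punchIn x with u ≟ punchIn u x
  ... | yes u≡ux = ⊥-elim (punchInᵢ≢i u x (sym u≡ux))
  ... | no  _    = trans (punchOut-cong u refl) (punchOut-punchIn u)

  merge : Fin (suc n) → Fin (suc n)
  merge = punchIn u ∘ collapse

  merge-invariant : (P : Fin (suc n) → Set) → P u ⇔ P w → ∀ a → P a ⇔ P (merge a)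
  merge-invariant P Pu⇔Pw a with u ≟ a
  ... | yes refl = subst (λ y → P u ⇔ P y) (sym (punchIn-punchOut u≢w)) Pu⇔Pw
  ... | no  u≢a  = subst (λ y → P a ⇔ P y) (sym (punchIn-punchOut u≢a)) ⇔.refl

  merge-invariant₂ : (R : Fin (suc n) → Fin (suc n) → Set) → (∀ {a b} → R a b → R b a) →
                     (∀ {b} → R u b ⇔ R w b) → ∀ {a b} → R a b ⇔ R (merge a) (merge b)
  merge-invariant₂ R R-sym Ru⇔Rw {a} {b} =
    ⇔.trans (merge-invariant (λ x → R x b) Ru⇔Rw a)
            (merge-invariant (R (merge a)) R-u⇔R-w b)
    where
    R-u⇔R-w : R (merge a) u ⇔ R (merge a) w
    R-u⇔R-w = mk⇔ (R-sym ∘ Equivalence.to Ru⇔Rw ∘ R-sym)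
                  (R-sym ∘ Equivalence.from Ru⇔Rw ∘ R-sym)

  collapse-hom : ∀ {a b} → Adj G a b → Adj (G ─ u) (collapse a) (collapse b)
  collapse-hom = Equivalence.to (merge-invariant₂ (Adj G) (Graph.sym G)
    (mk⇔ (twin-leaf-Adj {G = G} lu vu vw) (twin-leaf-Adj {G = G} lw vw vu)))

  merge-Reach⇔ : ∀ {k a b} → Reach G (2 + k) a b ⇔ Reach G (2 + k) (merge a) (merge b)
  merge-Reach⇔ {k} = merge-invariant₂ (Reach G (2 + k)) Reach-sym
    (mk⇔ (twin-leaf-Reach lu vw vu) (twin-leaf-Reach lw vu vw))

  collapse-retract : ∀ {k} → Retract (2 + k) G (G ─ u)
  collapse-retract = record
    { section         = punchIn u
    ; retract         = collapse
    ; retract-section = collapse-punchIn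
    ; Reach⇔          = mk⇔ (Reach-map collapse collapse-hom)
                            (Equivalence.from merge-Reach⇔ ∘ Reach-map (punchIn u) id)
    }

mainTheorem10 : ∀ {n : ℕ} (T : Graph (suc n)) (u v w : Fin (suc n)) →
    IsTree T → IsLeaf T u → IsLeaf T w → u ≢ w →
    Adj T v u → Adj T v w →
    ∀ (g : ℕ) → IsEternalAllDomNum T 2 g ⇔ IsEternalAllDomNum (T ─ u) 2 g
mainTheorem10 T u v w _ lu lw u≢w vu vw =
  IsEternalAllDomNum-cong (Retract⇒EternalDefends⇔ (TwinLeaves.collapse-retract T lu lw u≢w vu vw {0}))
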